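{- Let $\mathcal{B}$ be the collection of bases of a symplectic matroid on $E_{\pm n}$, and let $\mathcal{C}$ be the collection of minimal admissible subsets of $E_{\pm n}$ not contained in any member of $\mathcal{B}$. Let $P$ be an admissible subset of $E_{\pm n}$ and $B\in\mathcal{B}$. If $|P|<|B|$, then $P$ does not span $E_{\pm n}-(P\cup P^*)$, i.e. there exists $x\in E_{\pm n}-(P\cup P^*)$ that $P$ does not span.
   Context: Let $E_{\pm n}=[n]\cup[n]^*$ where $[n]^*=\{1^*,\dots,n^*\}$ and $*$ is the involution $i\leftrightarrow i^*$; $S^*=\{s^*:s\in S\}$. A set $S$ is admissible if $S\cap S^*=\emptyset$. A linear ordering $<$ on $E_{\pm n}$ is admissible if $i<j$ implies $j^*<i^*$. For admissible $k$-sets $A=\{a_1<\dots<a_k\}$, $B=\{b_1<\dots<b_k\}$ set $A\le B$ iff $a_i\le b_i$ for all $i$. A symplectic matroid is a pair $(E_{\pm n};\mathcal{B})$ with $\mathcal{B}$ a non-empty family of equi-numerous admissible subsets of $E_{\pm n}$ such that for every admissible ordering, $\mathcal{B}$ has a unique maximal element in the induced order. An admissible set $P$ spans $x\in E_{\pm n}$ (with respect to $\mathcal{C}$) if there exists $J\in\mathcal{C}$ with $J-P=\{x\}$. -}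

module Defs where

open import Data.Bool using (Bool; true; false; not; _∧_)
open import Data.Nat using (ℕ; _≤_; _<_)
open import Data.Fin using (Fin)
open import Data.Sum using (_⊎_; inj₁; inj₂)
open import Data.Product using (_×_; _,_; ∃; ∃-syntax; Σ-syntax)
open import Data.List using (List; _++_; map; length; filterᵇ)
open import Data.List using () renaming (allFin to allFinL)
open import Data.Vec using (lookup)
open import Relation.Binary.PropositionalEquality using (_≡_)
open import Relation.Nullary using (¬_)
import Data.Fin.Subset as Sub

-- The ground set E_{±n} = [n] ∪ [n]^* : inj₁ i is i, inj₂ i is i^*.
E : ℕ → Set
E n = Fin n ⊎ Fin n

_* : ∀ {n} → E n → E n
inj₁ i * = inj₂ i
inj₂ i * = inj₁ i

elems : ∀ n → List (E n)
elems n = map inj₁ (allFinL n) ++ map inj₂ (allFinL n)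

-- subsets of E_{±n}: (unstarred part , starred part)
SSet : ℕ → Set
SSet n = Sub.Subset n × Sub.Subset n

mem : ∀ {n} → SSet n → E n → Bool
mem (U , S) (inj₁ i) = lookup U i
mem (U , S) (inj₂ i) = lookup S i

_∈ₛ_ : ∀ {n} → E n → SSet n → Set
x ∈ₛ A = mem A x ≡ true

_⊆ₛ_ : ∀ {n} → SSet n → SSet n → Set
A ⊆ₛ B = ∀ x → x ∈ₛ A → x ∈ₛ B

_−ₛ_ : ∀ {n} → SSet n → SSet n → SSet n
(U , S) −ₛ (U' , S') = (U Sub.─ U') , (S Sub.─ S')

⁅_⁆ₛ : ∀ {n} → E n → SSet n
⁅ inj₁ i ⁆ₛ = Sub.⁅ i ⁆ , Sub.⊥
⁅ inj₂ i ⁆ₛ = Sub.⊥ , Sub.⁅ i ⁆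

count : ∀ {n} → (E n → Bool) → ℕ
count {n} p = length (filterᵇ p (elems n))

∣_∣ₛ : ∀ {n} → SSet n → ℕ
∣ A ∣ₛ = count (mem A)

Admissible : ∀ {n} → SSet n → Set
Admissible A = ∀ x → x ∈ₛ A → mem A (x *) ≡ false

-- A linear ordering on E_{±n}, given by an injective rank function r
-- (x < y iff r x < r y); admissible if i < j implies j^* < i^*.
AdmissibleOrdering : ∀ {n} → (E n → ℕ) → Set
AdmissibleOrdering {n} r =
  (∀ x y → r x ≡ r y → x ≡ y) × (∀ i j → r i < r j → r (j *) < r (i *))

-- position of a in A w.r.t. the ordering r (0-based): a is a_{pos+1}
posIn : ∀ {n} → (E n → ℕ) → SSet n → E n → ℕ
posIn r A a = count (λ a' → mem A a' ∧ (r a' Data.Nat.<ᵇ r a))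

-- Induced order on k-sets: A ≤ B iff a_i ≤ b_i for all i,
-- where a_i, b_i are the i-th smallest elements of A, B.
GaleLeq : ∀ {n} → (E n → ℕ) → SSet n → SSet n → Set
GaleLeq r A B = ∀ a b → a ∈ₛ A → b ∈ₛ B → posIn r A a ≡ posIn r B b → r a ≤ r b

Maximal : ∀ {n} → (E n → ℕ) → (SSet n → Set) → SSet n → Set
Maximal r 𝓑 M = 𝓑 M × (∀ A → 𝓑 A → GaleLeq r M A → A ≡ M)

record IsSymplecticMatroid {n : ℕ} (𝓑 : SSet n → Set) : Set where
  field
    nonempty    : ∃[ B ] 𝓑 B
    admissible  : ∀ B → 𝓑 B → Admissible B
    equinumerous : ∀ A B → 𝓑 A → 𝓑 B → ∣ A ∣ₛ ≡ ∣ B ∣ₛ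
    uniqueMax   : ∀ (r : E n → ℕ) → AdmissibleOrdering r →
                  ∃[ M ] (Maximal r 𝓑 M × (∀ M' → Maximal r 𝓑 M' → M' ≡ M))

Dependent : ∀ {n} → (SSet n → Set) → SSet n → Set
Dependent 𝓑 C = Admissible C × (∀ B → 𝓑 B → ¬ (C ⊆ₛ B))

Circuit : ∀ {n} → (SSet n → Set) → SSet n → Set
Circuit 𝓑 C = Dependent 𝓑 C × (∀ D → Dependent 𝓑 D → D ⊆ₛ C → D ≡ C)

Spans : ∀ {n} → (SSet n → Set) → SSet n → E n → Set
Spans 𝓑 P x = ∃[ J ] (Circuit 𝓑 J × (J −ₛ P) ≡ ⁅ x ⁆ₛ)

module Submission where

open import Defs
open import Data.Nat using (ℕ; _<_)
open import Data.Bool using (false)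
open import Data.Product using (_×_; ∃-syntax)
open import Relation.Binary.PropositionalEquality using (_≡_)
open import Relation.Nullary using (¬_)

-- Let M₁ be the maximal basis for an admissible ordering that ranks P on top;
-- then no basis meets P in more elements than M₁. Since |P| < |M₁|, some pair {x, x*} meets M₁
-- but not P; take x ∈ M₁. If a circuit J had J − P = {x}, then D = J − {x} ⊆ P would be
-- independent, say D ⊆ B₀. Let M₃ be the maximal basis for an ordering ranking D on top, then
-- P − D, then x. Comparing M₃ with B₀ gives D ⊆ M₃, and comparing M₁ and M₃ in both orderings
-- gives x ∈ M₃; so the dependent set J lies in the basis M₃, a contradiction. Domination is obtained in
-- double-negated form, which suffices because the conclusion ¬ Spans 𝓑 P x is a negation.

open import Data.Bool using (Bool; true; not; _∧_; _∨_; if_then_else_)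
open import Data.Bool.Properties
  using (∧-zeroʳ; ∧-identityʳ; ∨-identityʳ; ∨-conicalˡ; ∨-conicalʳ; ¬-not; not-involutive)
  renaming (_≟_ to _≟ᵇ_)
open import Data.Nat using (zero; suc; _+_; _*_; _∸_; _≤_; z≤n; s≤s; _<ᵇ_; _<?_)
open import Data.Nat.Properties
open import Data.Fin using (Fin; toℕ) renaming (zero to fzero; suc to fsuc)
open import Data.Fin.Properties using (toℕ<n; toℕ-injective)
import Data.Fin.Subset as Sub
open import Data.Fin.Subset.Properties using (∉⊥; x∈⁅x⁆; x∈⁅y⁆⇒x≡y)
open import Data.Sum using (_⊎_; inj₁; inj₂)
open import Data.List using (List; []; _∷_; length; filterᵇ; map; _++_; allFin)
open import Data.List.Membership.Propositional using (_∈_)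
open import Data.List.Membership.Propositional.Properties using (∈-allFin; ∈-map⁺; ∈-map⁻; ∈-++⁺ˡ; ∈-++⁺ʳ)
open import Data.List.Relation.Unary.Any using (here; there)
open import Data.List.Relation.Unary.All using (All; []; _∷_)
open import Data.List.Relation.Unary.AllPairs using (_∷_)
open import Data.List.Relation.Unary.Unique.Propositional using (Unique)
import Data.List.Relation.Unary.Unique.Propositional.Properties as UniqueProps
open import Data.Vec using (Vec; lookup; _∷_)
open import Data.Vec.Properties using (tabulate∘lookup; tabulate-cong; lookup⇒[]=; []=⇒lookup)
import Data.Vec.Properties as VecProps
import Data.Product.Properties as ProductProps
open import Data.Product using (_,_; proj₁; proj₂)
open import Data.Empty using (⊥; ⊥-elim)
open import Function using (_∘_)
open import Relation.Nullary using (Dec; yes; no)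
open import Relation.Nullary.Negation using (¬¬-map)
open import Relation.Nullary.Reflects using (Reflects; ofʸ; ofⁿ; det; invert; ¬-reflects)
open import Relation.Binary.Definitions using (tri<; tri≈; tri>)
open import Relation.Binary.PropositionalEquality using (_≢_; refl; sym; trans; cong; cong₂; subst; subst₂; module ≡-Reasoning)

bit : Bool → ℕ
bit true = 1
bit false = 0

bit-injective : ∀ {a b} → bit a ≡ bit b → a ≡ b
bit-injective {true} {true} _ = refl
bit-injective {false} {false} _ = refl

true≢false : true ≢ false
true≢false ()

module _ {A : Set} {b : Bool} (r : Reflects A b) where
  reflects-true : A → b ≡ true
  reflects-true a = det r (ofʸ a)

  reflects-false : ¬ A → b ≡ false
  reflects-false ¬a = det r (ofⁿ ¬a)

  reflects-sound : b ≡ true → A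
  reflects-sound refl = invert r

  reflects-refute : b ≡ false → ¬ A
  reflects-refute refl = invert r

reflects-≡ : ∀ {A B : Set} {a b : Bool} → Reflects A a → Reflects B b → (A → B) → (B → A) → a ≡ b
reflects-≡ (ofʸ x) rb f g = sym (reflects-true rb (f x))
reflects-≡ (ofⁿ ¬x) rb f g = sym (reflects-false rb (λ y → ¬x (g y)))

∧-left : ∀ {a b} → a ∧ b ≡ true → a ≡ true
∧-left {true} _ = refl

∧-right : ∀ {a b} → a ∧ b ≡ true → b ≡ true
∧-right {true} e = e

∧-intro : ∀ {a b} → a ≡ true → b ≡ true → a ∧ b ≡ true
∧-intro refl refl = refl

cnt : ∀ {A : Set} → (A → Bool) → List A → ℕ
cnt p l = length (filterᵇ p l)

module _ {A : Set} where

  cnt-ext : ∀ {p q : A → Bool} l → (∀ x → p x ≡ q x) → cnt p l ≡ cnt q l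
  cnt-ext [] h = refl
  cnt-ext {p} {q} (x ∷ l) h with p x | q x | h x
  ... | true  | true  | _ = cong suc (cnt-ext l h)
  ... | false | false | _ = cnt-ext l h

  cnt-mono : ∀ {p q : A → Bool} l → (∀ x → p x ≡ true → q x ≡ true) → cnt p l ≤ cnt q l
  cnt-mono [] h = z≤n
  cnt-mono {p} {q} (x ∷ l) h with p x | q x | h x
  ... | true  | true  | _ = s≤s (cnt-mono l h)
  ... | true  | false | hx with () ← hx refl
  ... | false | true  | _ = m≤n⇒m≤1+n (cnt-mono l h)
  ... | false | false | _ = cnt-mono l h

  cnt-strict : ∀ {p q : A → Bool} l → (∀ x → p x ≡ true → q x ≡ true) →
    ∀ {y} → y ∈ l → p y ≡ false → q y ≡ true → cnt p l < cnt q l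
  cnt-strict (x ∷ l) h (here refl) py qy rewrite py | qy = s≤s (cnt-mono l h)
  cnt-strict {p} {q} (x ∷ l) h (there y∈l) py qy with p x | q x | h x
  ... | true  | true  | _ = s≤s (cnt-strict l h y∈l py qy)
  ... | true  | false | hx with () ← hx refl
  ... | false | true  | _ = m<n⇒m<1+n (cnt-strict l h y∈l py qy)
  ... | false | false | _ = cnt-strict l h y∈l py qy

  witness-∷ : ∀ {P : A → Set} {x l} → ∃[ y ] (y ∈ l × P y) → ∃[ y ] (y ∈ x ∷ l × P y)
  witness-∷ (y , y∈l , Py) = y , there y∈l , Py

  cnt-witness : ∀ {p q : A → Bool} l → cnt p l < cnt q l →
    ∃[ x ] (x ∈ l × (q x ≡ true × p x ≡ false))
  cnt-witness {p} {q} (x ∷ l) lt with p x in px | q x in qx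
  ... | false | true  = x , here refl , qx , px
  ... | true  | true  = witness-∷ (cnt-witness l (≤-pred lt))
  ... | true  | false = witness-∷ (cnt-witness l (<-trans (n<1+n _) lt))
  ... | false | false = witness-∷ (cnt-witness l lt)

  cnt-split : ∀ (p q : A → Bool) l →
    cnt p l ≡ cnt (λ x → p x ∧ q x) l + cnt (λ x → p x ∧ not (q x)) l
  cnt-split p q [] = refl
  cnt-split p q (x ∷ l) with p x | q x
  ... | true  | true  = cong suc (cnt-split p q l)
  ... | true  | false = trans (cong suc (cnt-split p q l)) (sym (+-suc _ _))
  ... | false | _     = cnt-split p q l

  cnt-∨∧ : ∀ (p q : A → Bool) l →
    cnt p l + cnt q l ≡ cnt (λ x → p x ∨ q x) l + cnt (λ x → p x ∧ q x) l
  cnt-∨∧ p q [] = refl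
  cnt-∨∧ p q (x ∷ l) with p x | q x
  ... | true  | true  = cong suc (trans (+-suc _ _) (trans (cong suc (cnt-∨∧ p q l)) (sym (+-suc _ _))))
  ... | true  | false = cong suc (cnt-∨∧ p q l)
  ... | false | true  = trans (+-suc _ _) (cong suc (cnt-∨∧ p q l))
  ... | false | false = cnt-∨∧ p q l

  cnt-false : ∀ l → cnt (λ (_ : A) → false) l ≡ 0
  cnt-false [] = refl
  cnt-false (x ∷ l) = cnt-false l

  cnt-none : ∀ {p : A → Bool} l → All (λ x → p x ≡ false) l → cnt p l ≡ 0
  cnt-none [] [] = refl
  cnt-none (x ∷ l) (px ∷ ps) rewrite px = cnt-none l ps

  cnt-≤1 : ∀ {p : A → Bool} l → Unique l →
    (∀ x y → p x ≡ true → p y ≡ true → x ≡ y) → cnt p l ≤ 1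
  cnt-≤1 [] _ _ = z≤n
  cnt-≤1 {p} (x ∷ l) (x∉l ∷ u) h with p x in px
  ... | true  = s≤s (≤-reflexive (cnt-none l (others l x∉l)))
    where
    others : ∀ l' → All (x ≢_) l' → All (λ y → p y ≡ false) l'
    others [] [] = []
    others (y ∷ l') (x≢y ∷ x∉l') with p y in py
    ... | true  = ⊥-elim (x≢y (h x y px py))
    ... | false = py ∷ others l' x∉l'
  ... | false = cnt-≤1 l u h

  cnt-single : ∀ {p : A → Bool} l → Unique l → ∀ {y} → y ∈ l →
    (∀ x → p x ≡ true → x ≡ y) → cnt p l ≡ bit (p y)
  cnt-single {p} l u {y} y∈l h with p y in py
  ... | true  = ≤-antisym (cnt-≤1 l u (λ x z px pz → trans (h x px) (sym (h z pz))))
                          (subst (_< cnt p l) (cnt-false l) (cnt-strict l (λ _ ()) y∈l refl py))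
  ... | false = n≤0⇒n≡0 (≤-trans (cnt-mono l never) (≤-reflexive (cnt-false l)))
    where
    never : ∀ x → p x ≡ true → false ≡ true
    never x px with h x px
    ... | refl = trans (sym py) px

  cnt-∧-full : ∀ (p q : A → Bool) l → cnt q l ≤ cnt (λ x → p x ∧ q x) l →
    ∀ {y} → y ∈ l → q y ≡ true → p y ≡ true
  cnt-∧-full p q l le {y} y∈l qy with p y in py
  ... | true  = refl
  ... | false = ⊥-elim (<⇒≱ (cnt-strict l (λ x → ∧-right {p x}) y∈l (cong (_∧ q y) py) qy) le)

cnt-++ : ∀ {A : Set} (p : A → Bool) l₁ l₂ → cnt p (l₁ ++ l₂) ≡ cnt p l₁ + cnt p l₂
cnt-++ p [] l₂ = refl
cnt-++ p (x ∷ l₁) l₂ with p x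
... | true  = cong suc (cnt-++ p l₁ l₂)
... | false = cnt-++ p l₁ l₂

cnt-map : ∀ {A B : Set} (p : B → Bool) (g : A → B) l → cnt p (map g l) ≡ cnt (p ∘ g) l
cnt-map p g [] = refl
cnt-map p g (x ∷ l) with p (g x)
... | true  = cong suc (cnt-map p g l)
... | false = cnt-map p g l

∈-elems : ∀ {n} (e : E n) → e ∈ elems n
∈-elems (inj₁ i) = ∈-++⁺ˡ (∈-map⁺ inj₁ (∈-allFin i))
∈-elems {n} (inj₂ i) = ∈-++⁺ʳ (map inj₁ (allFin n)) (∈-map⁺ inj₂ (∈-allFin i))

unique-elems : ∀ n → Unique (elems n)
unique-elems n =
  UniqueProps.++⁺ (UniqueProps.map⁺ (λ { refl → refl }) (UniqueProps.allFin⁺ n))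
             (UniqueProps.map⁺ (λ { refl → refl }) (UniqueProps.allFin⁺ n)) disjoint
  where
  disjoint : ∀ {v} → ¬ (v ∈ map inj₁ (allFin n) × v ∈ map inj₂ (allFin n))
  disjoint (v₁ , v₂) with ∈-map⁻ inj₁ v₁ | ∈-map⁻ inj₂ v₂
  ... | _ , _ , refl | _ , _ , ()

sset-ext : ∀ {n} (A B : SSet n) → (∀ e → mem A e ≡ mem B e) → A ≡ B
sset-ext (U , S) (U' , S') h = cong₂ _,_ (vec-ext (λ i → h (inj₁ i))) (vec-ext (λ i → h (inj₂ i)))
  where
  vec-ext : ∀ {m} {V W : Vec Bool m} → (∀ i → lookup V i ≡ lookup W i) → V ≡ W
  vec-ext {V = V} {W} h = trans (sym (tabulate∘lookup V)) (trans (tabulate-cong h) (tabulate∘lookup W))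

_≟ₛ_ : ∀ {n} (A B : SSet n) → Dec (A ≡ B)
_≟ₛ_ = ProductProps.≡-dec (VecProps.≡-dec _≟ᵇ_) (VecProps.≡-dec _≟ᵇ_)

mem-─ : ∀ {n} (p q : Sub.Subset n) i → lookup (p Sub.─ q) i ≡ lookup p i ∧ not (lookup q i)
mem-─ (x ∷ p) (true ∷ q) fzero = sym (∧-zeroʳ x)
mem-─ (x ∷ p) (false ∷ q) fzero = sym (∧-identityʳ x)
mem-─ (x ∷ p) (y ∷ q) (fsuc i) = mem-─ p q i

mem-−ₛ : ∀ {n} (A B : SSet n) e → mem (A −ₛ B) e ≡ mem A e ∧ not (mem B e)
mem-−ₛ (U , S) (U' , S') (inj₁ i) = mem-─ U U' i
mem-−ₛ (U , S) (U' , S') (inj₂ i) = mem-─ S S' i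

mem-⁅⁆-self : ∀ {n} (x : E n) → mem ⁅ x ⁆ₛ x ≡ true
mem-⁅⁆-self (inj₁ i) = []=⇒lookup (x∈⁅x⁆ i)
mem-⁅⁆-self (inj₂ i) = []=⇒lookup (x∈⁅x⁆ i)

mem-⁅⁆ : ∀ {n} (x y : E n) → mem ⁅ x ⁆ₛ y ≡ true → y ≡ x
mem-⁅⁆ (inj₁ i) (inj₁ j) e = cong inj₁ (x∈⁅y⁆⇒x≡y i (lookup⇒[]= j _ e))
mem-⁅⁆ (inj₁ i) (inj₂ j) e = ⊥-elim (∉⊥ (lookup⇒[]= j _ e))
mem-⁅⁆ (inj₂ i) (inj₁ j) e = ⊥-elim (∉⊥ (lookup⇒[]= j _ e))
mem-⁅⁆ (inj₂ i) (inj₂ j) e = cong inj₂ (x∈⁅y⁆⇒x≡y i (lookup⇒[]= j _ e))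

*-involutive : ∀ {n} (e : E n) → (e *) * ≡ e
*-involutive (inj₁ i) = refl
*-involutive (inj₂ i) = refl

*-no-fixpoint : ∀ {n} (e : E n) → e * ≢ e
*-no-fixpoint (inj₁ i) ()
*-no-fixpoint (inj₂ i) ()

intermediate-value : ∀ (h : ℕ → ℕ) R p → h 0 ≤ p → p < h R → ∃[ s ] (h s ≤ p × p < h (suc s))
intermediate-value h zero p h0≤p p<h0 = ⊥-elim (<⇒≱ p<h0 h0≤p)
intermediate-value h (suc R) p h0≤p p<hR with p <? h R
... | yes p<h = intermediate-value h R p h0≤p p<h
... | no p≮h = R , ≮⇒≥ p≮h , p<hR

squeeze : ∀ {b c p} → c ≤ 1 → b ≤ p → p < b + c → b ≡ p × 0 < c
squeeze {b} {c} {p} c≤1 b≤p p<b+c =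
  ≤-antisym b≤p (≤-pred (≤-trans p<b+c (≤-trans (+-monoʳ-≤ b c≤1) (≤-reflexive (+-comm b 1))))) ,
  +-cancelˡ-< b 0 c (≤-<-trans (≤-reflexive (+-identityʳ b)) (≤-<-trans b≤p p<b+c))

sumTo : ℕ → (ℕ → ℕ) → ℕ
sumTo zero f = 0
sumTo (suc R) f = f R + sumTo R f

sum-mono : ∀ R {f g} → (∀ t → f t ≤ g t) → sumTo R f ≤ sumTo R g
sum-mono zero le = z≤n
sum-mono (suc R) le = +-mono-≤ (le R) (sum-mono R le)

sum-bound : ∀ R {f} k → (∀ t → f t ≤ k) → sumTo R f ≤ R * k
sum-bound zero k le = z≤n
sum-bound (suc R) k le = +-mono-≤ (le R) (sum-bound R k le)

+-rigid : ∀ {a b c d} → a ≤ c → b ≤ d → a + b ≡ c + d → a ≡ c × b ≡ d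
+-rigid {a} {b} {c} {d} a≤c b≤d eq =
  ≤-antisym a≤c (+-cancelʳ-≤ b c a (≤-trans (+-monoʳ-≤ c b≤d) (≤-reflexive (sym eq)))) ,
  ≤-antisym b≤d (+-cancelˡ-≤ a d b (≤-trans (+-monoˡ-≤ d a≤c) (≤-reflexive (sym eq))))

sum-rigid : ∀ R {f g} → (∀ t → f t ≤ g t) → sumTo R f ≡ sumTo R g → ∀ t → t < R → f t ≡ g t
sum-rigid (suc R) le eq t t<1+R with +-rigid (le R) (sum-mono R le) eq | m≤n⇒m<n∨m≡n (≤-pred t<1+R)
... | _ , rest | inj₁ t<R = sum-rigid R le rest t t<R
... | last , _ | inj₂ refl = last

-- The position posIn r A a of a in A is below A (r a) by definition.
module Ranked {n} (r : E n → ℕ) (r-inj : ∀ x y → r x ≡ r y → x ≡ y) (R : ℕ) (r<R : ∀ e → r e < R) where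

  below above slice : SSet n → ℕ → ℕ
  below A t = count (λ a → mem A a ∧ (r a <ᵇ t))
  above A t = count (λ a → mem A a ∧ not (r a <ᵇ t))
  slice A t = count (λ a → (mem A a ∧ not (r a <ᵇ t)) ∧ (r a <ᵇ suc t))

  size-split : ∀ A t → ∣ A ∣ₛ ≡ below A t + above A t
  size-split A t = cnt-split (mem A) (λ a → r a <ᵇ t) (elems n)

  above-≡ : ∀ A t → above A t ≡ ∣ A ∣ₛ ∸ below A t
  above-≡ A t = sym (trans (cong (_∸ below A t) (size-split A t)) (m+n∸m≡n (below A t) (above A t)))

  below-mono : ∀ A {s t} → s ≤ t → below A s ≤ below A t
  below-mono A {s} {t} s≤t = cnt-mono (elems n) λ a e →
    ∧-intro (∧-left e) (reflects-true (<ᵇ-reflects-< (r a) t)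
      (<-≤-trans (reflects-sound (<ᵇ-reflects-< (r a) s) (∧-right e)) s≤t))

  below-zero : ∀ A → below A 0 ≡ 0
  below-zero A = trans (cnt-ext (elems n) (λ a → ∧-zeroʳ (mem A a))) (cnt-false (elems n))

  below-all : ∀ A → below A R ≡ ∣ A ∣ₛ
  below-all A = cnt-ext (elems n) λ a →
    trans (cong (mem A a ∧_) (reflects-true (<ᵇ-reflects-< (r a) R) (r<R a))) (∧-identityʳ (mem A a))

  below-strict : ∀ A {t} a → mem A a ≡ true → r a < t → below A (r a) < below A t
  below-strict A {t} a a∈A ra<t =
    cnt-strict (elems n) (λ b e → ∧-intro (∧-left e) (reflects-true (<ᵇ-reflects-< (r b) t)
                                    (<-trans (reflects-sound (<ᵇ-reflects-< (r b) (r a)) (∧-right e)) ra<t)))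
               (∈-elems a)
               (trans (cong (mem A a ∧_) (reflects-false (<ᵇ-reflects-< (r a) (r a)) (<-irrefl refl)))
                      (∧-zeroʳ (mem A a)))
               (∧-intro a∈A (reflects-true (<ᵇ-reflects-< (r a) t) ra<t))

  above-vanishes : ∀ A {t} → R ≤ t → above A t ≡ 0
  above-vanishes A {t} R≤t = trans (cnt-ext (elems n) λ a →
      trans (cong (λ b → mem A a ∧ not b) (reflects-true (<ᵇ-reflects-< (r a) t) (<-≤-trans (r<R a) R≤t)))
            (∧-zeroʳ (mem A a)))
    (cnt-false (elems n))

  rank-exact : ∀ {a s} → not (r a <ᵇ s) ≡ true → (r a <ᵇ suc s) ≡ true → r a ≡ s
  rank-exact {a} {s} ¬lt lt = ≤-antisym (≤-pred (reflects-sound (<ᵇ-reflects-< (r a) (suc s)) lt))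
                                        (≮⇒≥ (reflects-sound (¬-reflects (<ᵇ-reflects-< (r a) s)) ¬lt))

  in-slice : ∀ A s a → (mem A a ∧ not (r a <ᵇ s)) ∧ (r a <ᵇ suc s) ≡ true → r a ≡ s
  in-slice A s a e = rank-exact (∧-right {mem A a} (∧-left e)) (∧-right {mem A a ∧ _} e)

  slice-≤1 : ∀ A s → slice A s ≤ 1
  slice-≤1 A s = cnt-≤1 (elems n) (unique-elems n) λ a b ea eb →
    r-inj a b (trans (in-slice A s a ea) (sym (in-slice A s b eb)))

  slice-rank : ∀ A e → slice A (r e) ≡ bit (mem A e)
  slice-rank A e = trans (cnt-single (elems n) (unique-elems n) (∈-elems e)
                            (λ a ea → r-inj a e (in-slice A (r e) a ea)))
                         (cong bit at-e)
    where
    at-e : (mem A e ∧ not (r e <ᵇ r e)) ∧ (r e <ᵇ suc (r e)) ≡ mem A e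
    at-e rewrite reflects-false (<ᵇ-reflects-< (r e) (r e)) (<-irrefl refl)
               | reflects-true (<ᵇ-reflects-< (r e) (suc (r e))) (n<1+n (r e))
               = trans (∧-identityʳ _) (∧-identityʳ _)

  above-split : ∀ A s → above A s ≡ slice A s + above A (suc s)
  above-split A s = trans (cnt-split _ (λ a → r a <ᵇ suc s) (elems n))
                          (cong (slice A s +_) (cnt-ext (elems n) higher))
    where
    higher : ∀ a → (mem A a ∧ not (r a <ᵇ s)) ∧ not (r a <ᵇ suc s) ≡ mem A a ∧ not (r a <ᵇ suc s)
    higher a with r a <ᵇ s in lt | r a <ᵇ suc s in lt'
    ... | false | _ = cong (_∧ _) (∧-identityʳ (mem A a))
    ... | true  | true  = trans (∧-zeroʳ _) (sym (∧-zeroʳ _))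
    ... | true  | false = ⊥-elim (reflects-refute (<ᵇ-reflects-< (r a) (suc s)) lt'
                            (m<n⇒m<1+n (reflects-sound (<ᵇ-reflects-< (r a) s) lt)))

  below-step : ∀ A s → below A (suc s) ≡ below A s + slice A s
  below-step A s = +-cancelʳ-≡ (above A (suc s)) _ _ (begin
    below A (suc s) + above A (suc s)            ≡⟨ sym (size-split A (suc s)) ⟩
    ∣ A ∣ₛ                                        ≡⟨ size-split A s ⟩
    below A s + above A s                        ≡⟨ cong (below A s +_) (above-split A s) ⟩
    below A s + (slice A s + above A (suc s))    ≡⟨ sym (+-assoc (below A s) _ _) ⟩
    below A s + slice A s + above A (suc s)      ∎)
    where open ≡-Reasoning

  position-exists : ∀ A p → p < ∣ A ∣ₛ → ∃[ a ] (mem A a ≡ true × posIn r A a ≡ p)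
  position-exists A p p<∣A∣
    with s , below≤p , p<below' ← intermediate-value (below A) R p (subst (_≤ p) (sym (below-zero A)) z≤n)
                                     (subst (p <_) (sym (below-all A)) p<∣A∣)
    with below≡p , occupied ← squeeze (slice-≤1 A s) below≤p (subst (p <_) (below-step A s) p<below')
    with a , _ , a∈slice , _ ← cnt-witness {p = λ _ → false} (elems n)
                                 (subst (_< slice A s) (sym (cnt-false (elems n))) occupied)
    = a , ∧-left (∧-left a∈slice) , trans (cong (below A) (in-slice A s a a∈slice)) below≡p

  Dominates : SSet n → SSet n → Set
  Dominates A B = ∀ t → above A t ≤ above B t

  -- for equinumerous sets the Gale order implies domination: if a is the element of A at the
  -- position p = |A ∩ [0,t)|, then t ≤ r a ≤ r b for the element b of B at position p,
  -- so |B ∩ [0,t)| ≤ p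
  gale-dominates : ∀ A B → ∣ A ∣ₛ ≡ ∣ B ∣ₛ → GaleLeq r A B → Dominates A B
  gale-dominates A B ∣A∣≡∣B∣ A≤B t = begin
      above A t            ≡⟨ above-≡ A t ⟩
      ∣ A ∣ₛ ∸ below A t   ≤⟨ ∸-mono (≤-reflexive ∣A∣≡∣B∣) (fewer-below (below A t <? ∣ A ∣ₛ)) ⟩
      ∣ B ∣ₛ ∸ below B t   ≡⟨ sym (above-≡ B t) ⟩
      above B t            ∎
    where
    open ≤-Reasoning
    fewer-below : Dec (below A t < ∣ A ∣ₛ) → below B t ≤ below A t
    fewer-below (no p≮∣A∣) = begin
      below B t                ≤⟨ m≤m+n (below B t) (above B t) ⟩
      below B t + above B t    ≡⟨ sym (size-split B t) ⟩
      ∣ B ∣ₛ                   ≡⟨ sym ∣A∣≡∣B∣ ⟩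
      ∣ A ∣ₛ                   ≤⟨ ≮⇒≥ p≮∣A∣ ⟩
      below A t                ∎
    fewer-below (yes p<∣A∣) = matched (position-exists A (below A t) p<∣A∣)
                                      (position-exists B (below A t) (subst (below A t <_) ∣A∣≡∣B∣ p<∣A∣))
      where
      matched : ∃[ a ] (mem A a ≡ true × posIn r A a ≡ below A t) →
                ∃[ b ] (mem B b ≡ true × posIn r B b ≡ below A t) → below B t ≤ below A t
      matched (a , a∈A , pos-a) (b , b∈B , pos-b) = begin
        below B t      ≤⟨ below-mono B (≤-trans t≤ra (A≤B a b a∈A b∈B (trans pos-a (sym pos-b)))) ⟩
        below B (r b)  ≡⟨ pos-b ⟩
        below A t      ∎
        where
        t≤ra : t ≤ r a
        t≤ra = ≮⇒≥ λ ra<t → <-irrefl pos-a (below-strict A a a∈A ra<t)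

  above-injective : ∀ A B → (∀ t → above A t ≡ above B t) → A ≡ B
  above-injective A B same = sset-ext A B λ e → bit-injective (+-cancelʳ-≡ (above A (suc (r e))) _ _ (begin
      bit (mem A e) + above A (suc (r e))    ≡⟨ cong (_+ above A (suc (r e))) (sym (slice-rank A e)) ⟩
      slice A (r e) + above A (suc (r e))    ≡⟨ sym (above-split A (r e)) ⟩
      above A (r e)                          ≡⟨ same (r e) ⟩
      above B (r e)                          ≡⟨ above-split B (r e) ⟩
      slice B (r e) + above B (suc (r e))    ≡⟨ cong₂ _+_ (slice-rank B e) (sym (same (suc (r e)))) ⟩
      bit (mem B e) + above A (suc (r e))    ∎))
    where open ≡-Reasoning

  weight : SSet n → ℕ
  weight A = sumTo R (above A)

  equal-weight : ∀ A B → Dominates A B → weight A ≡ weight B → A ≡ B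
  equal-weight A B dom eq = above-injective A B profile
    where
    profile : ∀ t → above A t ≡ above B t
    profile t with t <? R
    ... | yes t<R = sum-rigid R dom eq t t<R
    ... | no t≮R = trans (above-vanishes A (≮⇒≥ t≮R)) (sym (above-vanishes B (≮⇒≥ t≮R)))

  weight-increases : ∀ A B → Dominates A B → A ≢ B → weight A < weight B
  weight-increases A B dom A≢B = ≤∧≢⇒< (sum-mono R dom) (A≢B ∘ equal-weight A B dom)

  weight-bound : ∀ A → weight A ≤ R * ∣ A ∣ₛ
  weight-bound A = sum-bound R ∣ A ∣ₛ λ t →
    ≤-trans (m≤n+m (above A t) (below A t)) (≤-reflexive (sym (size-split A t)))

  -- If an ordering has a unique Gale-maximal basis M, then M dominates every basis A.
  -- Otherwise climb from A: a basis that is not maximal lies Gale-below a different basis,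
  -- which dominates it and is strictly heavier; weights are bounded, so the climb ends at a
  -- maximal basis, i.e. at M, and domination is transitive.
  module Maximum (𝓑 : SSet n → Set) (M : SSet n)
                 (M-unique : ∀ M' → Maximal r 𝓑 M' → M' ≡ M)
                 (equinumerous : ∀ A → 𝓑 A → ∣ A ∣ₛ ≡ ∣ M ∣ₛ) where

    summit-dominated : ∀ A → 𝓑 A → (∀ A' → 𝓑 A' → Dominates A A' → weight A < weight A' → ⊥) →
      Dominates A M
    summit-dominated A A∈𝓑 no-heavier = subst (Dominates A) (M-unique A (A∈𝓑 , maximal)) (λ t → ≤-refl)
      where
      maximal : ∀ A' → 𝓑 A' → GaleLeq r A A' → A' ≡ A
      maximal A' A'∈𝓑 A≤A' = decide (A' ≟ₛ A)
        where
        dom : Dominates A A'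
        dom = gale-dominates A A' (trans (equinumerous A A∈𝓑) (sym (equinumerous A' A'∈𝓑))) A≤A'
        decide : Dec (A' ≡ A) → A' ≡ A
        decide (yes A'≡A) = A'≡A
        decide (no A'≢A) = ⊥-elim (no-heavier A' A'∈𝓑 dom (weight-increases A A' dom (A'≢A ∘ sym)))

    -- each climbing step raises the weight, which never exceeds R * |M|; so from a basis with
    -- weight A + k ≥ R * |M| at most k further steps are possible
    climb : ∀ k A → 𝓑 A → R * ∣ M ∣ₛ ≤ weight A + k → ¬ ¬ Dominates A M
    climb zero A A∈𝓑 enough ¬dom = ¬dom (summit-dominated A A∈𝓑 λ A' A'∈𝓑 _ heavier →
      <⇒≱ heavier (begin
        weight A'            ≤⟨ weight-bound A' ⟩
        R * ∣ A' ∣ₛ          ≡⟨ cong (R *_) (equinumerous A' A'∈𝓑) ⟩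
        R * ∣ M ∣ₛ           ≤⟨ enough ⟩
        weight A + 0         ≡⟨ +-identityʳ (weight A) ⟩
        weight A             ∎))
      where open ≤-Reasoning
    climb (suc k) A A∈𝓑 enough ¬dom = ¬dom (summit-dominated A A∈𝓑 λ A' A'∈𝓑 dom heavier →
      climb k A' A'∈𝓑 (≤-trans enough (≤-trans (≤-reflexive (+-suc (weight A) k)) (+-monoˡ-≤ k heavier)))
            (λ dom' → ¬dom (λ t → ≤-trans (dom t) (dom' t))))

    dominated-by-max : ∀ A → 𝓑 A → ¬ ¬ Dominates A M
    dominated-by-max A A∈𝓑 = climb (R * ∣ M ∣ₛ) A A∈𝓑 (m≤n+m _ (weight A))

scaled-< : ∀ {n a b x y} → x < n → a < b → a * n + x < b * n + y
scaled-< {n} {a} {b} {x} {y} x<n a<b = begin-strict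
  a * n + x    <⟨ +-monoʳ-< (a * n) x<n ⟩
  a * n + n    ≡⟨ +-comm (a * n) n ⟩
  suc a * n    ≤⟨ *-monoˡ-≤ n a<b ⟩
  b * n        ≤⟨ m≤m+n (b * n) y ⟩
  b * n + y    ∎
  where open ≤-Reasoning

scaled-≤ : ∀ {n a b x} → x < n → b * n ≤ a * n + x → b ≤ a
scaled-≤ {n} {a} {b} {x} x<n b*n≤ = ≮⇒≥ λ a<b →
  <⇒≱ (scaled-< {y = 0} x<n a<b) (≤-trans (≤-reflexive (+-identityʳ (b * n))) b*n≤)

scaled-injective : ∀ {n a b x y} → x < n → y < n → a * n + x ≡ b * n + y → x ≡ y
scaled-injective {n} {a} {b} {x} {y} x<n y<n eq with <-cmp a b
... | tri< a<b _ _ = ⊥-elim (<-irrefl eq (scaled-< x<n a<b))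
... | tri> _ _ b<a = ⊥-elim (<-irrefl (sym eq) (scaled-< y<n b<a))
... | tri≈ _ refl _ = +-cancelˡ-≡ (a * n) x y eq

sum-swap : ∀ {a a' b b'} → a + a' ≡ b + b' → a < b → b' < a'
sum-swap eq a<b = ≰⇒> λ a'≤b' → <-irrefl eq (+-mono-<-≤ a<b a'≤b')

-- Put the element of each pair {i, i*} on
-- which f may be positive in the upper half, ranked by (f, i) lexicographically, and its
-- partner in the mirror position of the lower half. Then for every L the elements ranked above
-- a threshold are exactly those with f e > L.
module LevelOrdering {n} (K : ℕ) (f : E n → ℕ) (f≤K : ∀ e → f e ≤ K)
                     (support-admissible : ∀ e → 0 < f e → f (e *) ≡ 0) where

  positive : ℕ → Bool
  positive zero = false
  positive (suc _) = true

  isTop : E n → Bool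
  isTop (inj₁ i) = not (positive (f (inj₂ i)))
  isTop (inj₂ i) = positive (f (inj₂ i))

  index : E n → Fin n
  index (inj₁ i) = i
  index (inj₂ i) = i

  top : Fin n → E n
  top i = if positive (f (inj₂ i)) then inj₂ i else inj₁ i

  top-index : ∀ e → isTop e ≡ true → top (index e) ≡ e
  top-index (inj₁ i) t with positive (f (inj₂ i))
  ... | false = refl
  top-index (inj₂ i) t with positive (f (inj₂ i))
  top-index (inj₂ i) refl | true = refl

  bottom-level : ∀ e → isTop e ≡ false → f e ≡ 0
  bottom-level (inj₁ i) b with f (inj₂ i) in fi*
  ... | suc _ = support-admissible (inj₂ i) (subst (0 <_) (sym fi*) (s≤s z≤n))
  bottom-level (inj₂ i) b with f (inj₂ i)
  ... | zero = refl

  isTop-* : ∀ e → isTop (e *) ≡ not (isTop e)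
  isTop-* (inj₁ i) = sym (not-involutive _)
  isTop-* (inj₂ i) = refl

  index-* : ∀ e → index (e *) ≡ index e
  index-* (inj₁ i) = refl
  index-* (inj₂ i) = refl

  same-side : ∀ a b → index a ≡ index b → isTop a ≡ isTop b → a ≡ b
  same-side (inj₁ i) (inj₁ .i) refl _ = refl
  same-side (inj₂ i) (inj₂ .i) refl _ = refl
  same-side (inj₁ i) (inj₂ .i) refl t with positive (f (inj₂ i))
  same-side (inj₁ i) (inj₂ .i) refl () | true
  same-side (inj₁ i) (inj₂ .i) refl () | false
  same-side (inj₂ i) (inj₁ .i) refl t with positive (f (inj₂ i))
  same-side (inj₂ i) (inj₁ .i) refl () | true
  same-side (inj₂ i) (inj₁ .i) refl () | false

  height : Fin n → ℕ
  height i = f (top i) * n + toℕ i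

  N : ℕ
  N = suc K * n

  height<N : ∀ i → height i < N
  height<N i = <-≤-trans (scaled-< {y = 0} (toℕ<n i) (s≤s (f≤K (top i))))
                         (≤-reflexive (+-identityʳ N))

  height-injective : ∀ i j → height i ≡ height j → i ≡ j
  height-injective i j eq =
    toℕ-injective (scaled-injective {a = f (top i)} {b = f (top j)} (toℕ<n i) (toℕ<n j) eq)

  rank : Bool → ℕ → ℕ
  rank true x = N + suc x
  rank false x = N ∸ suc x

  r : E n → ℕ
  r e = rank (isTop e) (height (index e))

  r-top : ∀ e → isTop e ≡ true → r e ≡ N + suc (f e * n + toℕ (index e))
  r-top e t rewrite t | top-index e t = refl

  r-bottom : ∀ e → isTop e ≡ false → r e ≤ N
  r-bottom e b rewrite b = m∸n≤m N (suc (height (index e)))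

  r-sum : ∀ e → r e + r (e *) ≡ N + N
  r-sum e rewrite isTop-* e | index-* e = mirror (isTop e) (height<N (index e))
    where
    mirror : ∀ b {x} → x < N → rank b x + rank (not b) x ≡ N + N
    mirror true  {x} x<N = trans (+-assoc N (suc x) (N ∸ suc x)) (cong (N +_) (m+[n∸m]≡n x<N))
    mirror false {x} x<N = trans (+-comm (N ∸ suc x) (N + suc x)) (mirror true x<N)

  r<R : ∀ e → r e < suc (N + N)
  r<R e = s≤s (≤-trans (m≤m+n (r e) (r (e *))) (≤-reflexive (r-sum e)))

  bottom<top : ∀ {x y} → N ∸ suc x < N + suc y
  bottom<top {x} {y} = ≤-<-trans (m∸n≤m N (suc x)) (m<m+n N (s≤s z≤n))

  -- r is injective: heights are injective, and bottom ranks lie below top ranks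
  r-inj : ∀ a b → r a ≡ r b → a ≡ b
  r-inj a b eq with isTop a in ta | isTop b in tb
  ... | true  | true  = same-side a b (height-injective _ _ (suc-injective (+-cancelˡ-≡ N _ _ eq)))
                                      (trans ta (sym tb))
  ... | false | false = same-side a b (height-injective _ _ (suc-injective
                          (∸-cancelˡ-≡ (height<N (index a)) (height<N (index b)) eq))) (trans ta (sym tb))
  ... | true  | false = ⊥-elim (<-irrefl (sym eq) bottom<top)
  ... | false | true  = ⊥-elim (<-irrefl eq bottom<top)

  r-admissible : AdmissibleOrdering r
  r-admissible = r-inj , λ a b ra<rb → sum-swap (trans (r-sum a) (sym (r-sum b))) ra<rb

  -- the rank of a top element at level L + 1 and index 0
  threshold : ℕ → ℕ
  threshold L = N + suc (suc L * n)

  by-side : ∀ {P : Set} e → (isTop e ≡ true → P) → (isTop e ≡ false → P) → P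
  by-side {P} e if-top if-bottom = side (isTop e) refl
    where
    side : ∀ b → isTop e ≡ b → P
    side true  = if-top
    side false = if-bottom

  upper : ∀ L e → not (r e <ᵇ threshold L) ≡ (L <ᵇ f e)
  upper L e = by-side e upper-top upper-bottom
    where
    upper-top : isTop e ≡ true → not (r e <ᵇ threshold L) ≡ (L <ᵇ f e)
    upper-top t rewrite r-top e t =
      reflects-≡ (¬-reflects (<ᵇ-reflects-< _ _)) (<ᵇ-reflects-< L (f e))
        (λ ¬< → scaled-≤ (toℕ<n (index e)) (≤-pred (+-cancelˡ-≤ N _ _ (≮⇒≥ ¬<))))
        (λ L<fe → ≤⇒≯ (+-monoʳ-≤ N (s≤s (≤-trans (*-monoˡ-≤ n L<fe) (m≤m+n _ _)))))
    upper-bottom : isTop e ≡ false → not (r e <ᵇ threshold L) ≡ (L <ᵇ f e)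
    upper-bottom b rewrite bottom-level e b =
      cong not (reflects-true (<ᵇ-reflects-< _ _) (≤-<-trans (r-bottom e b) (m<m+n N (s≤s z≤n))))

size-by-pairs : ∀ {n} (A : SSet n) →
  ∣ A ∣ₛ ≡ cnt (λ i → mem A (inj₁ i) ∨ mem A (inj₂ i)) (allFin n)
         + cnt (λ i → mem A (inj₁ i) ∧ mem A (inj₂ i)) (allFin n)
size-by-pairs {n} A = begin
  ∣ A ∣ₛ
    ≡⟨ cnt-++ (mem A) (map inj₁ (allFin n)) (map inj₂ (allFin n)) ⟩
  cnt (mem A) (map inj₁ (allFin n)) + cnt (mem A) (map inj₂ (allFin n))
    ≡⟨ cong₂ _+_ (cnt-map (mem A) inj₁ (allFin n)) (cnt-map (mem A) inj₂ (allFin n)) ⟩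
  cnt (λ i → mem A (inj₁ i)) (allFin n) + cnt (λ i → mem A (inj₂ i)) (allFin n)
    ≡⟨ cnt-∨∧ (λ i → mem A (inj₁ i)) (λ i → mem A (inj₂ i)) (allFin n) ⟩
  cnt (λ i → mem A (inj₁ i) ∨ mem A (inj₂ i)) (allFin n)
    + cnt (λ i → mem A (inj₁ i) ∧ mem A (inj₂ i)) (allFin n)
    ∎
  where open ≡-Reasoning

admissible-no-pairs : ∀ {n} {A : SSet n} → Admissible A →
  cnt (λ i → mem A (inj₁ i) ∧ mem A (inj₂ i)) (allFin n) ≡ 0
admissible-no-pairs {n} {A} A-adm = trans (cnt-ext (allFin n) no-pair) (cnt-false (allFin n))
  where
  no-pair : ∀ i → mem A (inj₁ i) ∧ mem A (inj₂ i) ≡ false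
  no-pair i with mem A (inj₁ i) in i∈A
  ... | true  = A-adm (inj₁ i) i∈A
  ... | false = refl

free-element : ∀ {n} {M P : SSet n} → Admissible M → ∣ P ∣ₛ < ∣ M ∣ₛ →
  ∃[ x ] (mem M x ≡ true × mem P x ≡ false × mem P (x *) ≡ false)
free-element {n} {M} {P} M-adm ∣P∣<∣M∣ = choose (cnt-witness (allFin n) fewer-pairs)
  where
  fewer-pairs : cnt (λ i → mem P (inj₁ i) ∨ mem P (inj₂ i)) (allFin n)
              < cnt (λ i → mem M (inj₁ i) ∨ mem M (inj₂ i)) (allFin n)
  fewer-pairs = <-≤-trans (≤-<-trans (≤-trans (m≤m+n _ _) (≤-reflexive (sym (size-by-pairs P)))) ∣P∣<∣M∣)
                          (≤-reflexive (trans (size-by-pairs M)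
                             (trans (cong (cnt (λ i → mem M (inj₁ i) ∨ mem M (inj₂ i)) (allFin n) +_)
                                          (admissible-no-pairs M-adm)) (+-identityʳ _))))
  choose : ∃[ i ] (_ × (mem M (inj₁ i) ∨ mem M (inj₂ i) ≡ true × mem P (inj₁ i) ∨ mem P (inj₂ i) ≡ false)) →
           ∃[ x ] (mem M x ≡ true × mem P x ≡ false × mem P (x *) ≡ false)
  choose (i , _ , meets-M , misses-P) with mem M (inj₁ i) in i∈M
  ... | true  = inj₁ i , i∈M , ∨-conicalˡ _ _ misses-P , ∨-conicalʳ _ _ misses-P
  ... | false = inj₂ i , meets-M , ∨-conicalʳ _ _ misses-P , ∨-conicalˡ _ _ misses-P

∣_∩_∣ : ∀ {n} → SSet n → (E n → Bool) → ℕ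
∣ A ∩ T ∣ = count (λ e → mem A e ∧ T e)

∩-⊇ : ∀ {n} {A B : SSet n} → A ⊆ₛ B → ∣ B ∩ mem A ∣ ≡ ∣ A ∣ₛ
∩-⊇ {n} {A} {B} A⊆B = cnt-ext (elems n) inside
  where
  inside : ∀ e → mem B e ∧ mem A e ≡ mem A e
  inside e with mem A e in e∈A
  ... | true  = trans (∧-identityʳ (mem B e)) (A⊆B e e∈A)
  ... | false = ∧-zeroʳ (mem B e)

module Greedy {n} {𝓑 : SSet n → Set} (matroid : IsSymplecticMatroid 𝓑) where
  open IsSymplecticMatroid matroid

  IsGreedy : (E n → ℕ) → SSet n → Set
  IsGreedy f M = ∀ A → 𝓑 A → ¬ ¬ (∀ L T → (∀ e → (L <ᵇ f e) ≡ T e) → ∣ A ∩ T ∣ ≤ ∣ M ∩ T ∣)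

  -- every bounded level function with admissible support has a greedy basis: the maximal basis
  -- for the ordering realising its levels
  greedy-basis : ∀ K (f : E n → ℕ) → (∀ e → f e ≤ K) → (∀ e → 0 < f e → f (e *) ≡ 0) →
    ∃[ M ] (𝓑 M × IsGreedy f M)
  greedy-basis K f f≤K f-adm = from-max (uniqueMax r r-admissible)
    where
    open LevelOrdering K f f≤K f-adm
    open Ranked r r-inj (suc (N + N)) r<R
    level-count : ∀ A L T → (∀ e → (L <ᵇ f e) ≡ T e) → above A (threshold L) ≡ ∣ A ∩ T ∣
    level-count A L T T≡ = cnt-ext (elems n) λ e → cong (mem A e ∧_) (trans (upper L e) (T≡ e))
    from-max : ∃[ M ] (Maximal r 𝓑 M × (∀ M' → Maximal r 𝓑 M' → M' ≡ M)) → ∃[ M ] (𝓑 M × IsGreedy f M)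
    from-max (M , (M∈𝓑 , _) , M-unique) = M , M∈𝓑 , λ A A∈𝓑 →
      ¬¬-map (λ dom L T T≡ → subst₂ _≤_ (level-count A L T T≡) (level-count M L T T≡) (dom (threshold L)))
             (Maximum.dominated-by-max 𝓑 M M-unique (λ A' A'∈𝓑 → equinumerous A' M A'∈𝓑 M∈𝓑) A A∈𝓑)

twoLevel : ∀ {n} → (E n → Bool) → (E n → Bool) → E n → ℕ
twoLevel a b e = bit (a e) + bit (b e)

module TwoLevel {n} (a b : E n → Bool) (b⊆a : ∀ e → b e ≡ true → a e ≡ true) where

  bounded : ∀ e → twoLevel a b e ≤ 2
  bounded e = +-mono-≤ (bit≤1 (a e)) (bit≤1 (b e))
    where
    bit≤1 : ∀ c → bit c ≤ 1
    bit≤1 true = s≤s z≤n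
    bit≤1 false = z≤n

  levels : ∀ {c d} → (d ≡ true → c ≡ true) → (0 <ᵇ bit c + bit d) ≡ c × (1 <ᵇ bit c + bit d) ≡ d
  levels {true}  {true}  _ = refl , refl
  levels {true}  {false} _ = refl , refl
  levels {false} {false} _ = refl , refl
  levels {false} {true}  d⊆c with () ← d⊆c refl

  level₀ : ∀ e → (0 <ᵇ twoLevel a b e) ≡ a e
  level₀ e = proj₁ (levels (b⊆a e))

  level₁ : ∀ e → (1 <ᵇ twoLevel a b e) ≡ b e
  level₁ e = proj₂ (levels (b⊆a e))

  support-admissible : (∀ e → a e ≡ true → a (e *) ≡ false) →
    ∀ e → 0 < twoLevel a b e → twoLevel a b (e *) ≡ 0
  support-admissible a-adm e positive = zero-at (a-adm e in-a)
    where
    in-a : a e ≡ true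
    in-a = trans (sym (level₀ e)) (reflects-true (<ᵇ-reflects-< 0 _) positive)
    zero-at : ∀ {e'} → a e' ≡ false → twoLevel a b e' ≡ 0
    zero-at {e'} a≡false with b e' in b≡
    ... | false rewrite a≡false = refl
    ... | true = ⊥-elim (true≢false (trans (sym (b⊆a e' b≡)) a≡false))

add-admissible : ∀ {n} {T : E n → Bool} x → (∀ e → T e ≡ true → T (e *) ≡ false) →
  T (x *) ≡ false → ∀ e → T e ∨ mem ⁅ x ⁆ₛ e ≡ true → T (e *) ∨ mem ⁅ x ⁆ₛ (e *) ≡ false
add-admissible {T = T} x T-adm x*∉T e e∈T+x = cong₂ _∨_ T-partner x-partner
  where
  T-partner : T (e *) ≡ false
  T-partner with T e in e∈T
  ... | true  = T-adm e e∈T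
  ... | false = subst (λ y → T (y *) ≡ false) (sym (mem-⁅⁆ x e e∈T+x)) x*∉T
  x-partner : mem ⁅ x ⁆ₛ (e *) ≡ false
  x-partner = ¬-not λ e*≡x → *-no-fixpoint x (mem-⁅⁆ x (x *) (x*∈T+x (mem-⁅⁆ x (e *) e*≡x)))
    where
    x*∈T+x : e * ≡ x → mem ⁅ x ⁆ₛ (x *) ≡ true
    x*∈T+x refl rewrite *-involutive e = trans (cong (_∨ mem ⁅ e * ⁆ₛ e) (sym x*∉T)) e∈T+x

module SpanningCircuit {n} (P J : SSet n) (x : E n) (J−P≡x : (J −ₛ P) ≡ ⁅ x ⁆ₛ) where

  D : SSet n
  D = J −ₛ ⁅ x ⁆ₛ

  J−P : ∀ y → mem J y ∧ not (mem P y) ≡ mem ⁅ x ⁆ₛ y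
  J−P y = trans (sym (mem-−ₛ J P y)) (cong (λ A → mem A y) J−P≡x)

  x∈J : mem J x ≡ true
  x∈J = ∧-left (trans (J−P x) (mem-⁅⁆-self x))

  x∉D : mem D x ≡ false
  x∉D = trans (mem-−ₛ J ⁅ x ⁆ₛ x)
              (trans (cong (λ c → mem J x ∧ not c) (mem-⁅⁆-self x)) (∧-zeroʳ (mem J x)))

  D⊆J : D ⊆ₛ J
  D⊆J y y∈D = ∧-left (trans (sym (mem-−ₛ J ⁅ x ⁆ₛ y)) y∈D)

  D⊆P : D ⊆ₛ P
  D⊆P y y∈D = ¬-not λ y∉P → true≢false (begin
      true                           ≡⟨ sym (∧-right {mem J y} (trans (sym (mem-−ₛ J ⁅ x ⁆ₛ y)) y∈D)) ⟩
      not (mem ⁅ x ⁆ₛ y)             ≡⟨ cong not (sym (J−P y)) ⟩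
      not (mem J y ∧ not (mem P y))  ≡⟨ cong₂ (λ c d → not (c ∧ not d)) (D⊆J y y∈D) y∉P ⟩
      false                          ∎)
    where open ≡-Reasoning

  J⊆D+x : ∀ y → mem J y ≡ true → y ≡ x ⊎ mem D y ≡ true
  J⊆D+x y y∈J with mem ⁅ x ⁆ₛ y in y∈x
  ... | true  = inj₁ (mem-⁅⁆ x y y∈x)
  ... | false = inj₂ (trans (mem-−ₛ J ⁅ x ⁆ₛ y)
                            (trans (cong (λ c → mem J y ∧ not c) y∈x) (trans (∧-identityʳ (mem J y)) y∈J)))

  D-admissible : Admissible J → Admissible D
  D-admissible J-adm y y∈D = ¬-not λ y*∈D →
    true≢false (trans (sym (D⊆J (y *) y*∈D)) (J-adm y (D⊆J y y∈D)))

module NotSpanned {n} {𝓑 : SSet n → Set} (matroid : IsSymplecticMatroid 𝓑)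
                  (P : SSet n) (P-adm : Admissible P) where
  open IsSymplecticMatroid matroid
  open Greedy matroid

  none : E n → Bool
  none _ = false

  f₁ : E n → ℕ
  f₁ = twoLevel (mem P) none

  module L₁ = TwoLevel (mem P) none (λ _ ())

  greedy₁ : ∃[ M ] (𝓑 M × IsGreedy f₁ M)
  greedy₁ = greedy-basis 2 f₁ L₁.bounded (L₁.support-admissible P-adm)

  not-spanned : ∀ M₁ → 𝓑 M₁ → IsGreedy f₁ M₁ → ∀ x → mem M₁ x ≡ true → mem P x ≡ false →
    mem P (x *) ≡ false → ¬ Spans 𝓑 P x
  not-spanned M₁ M₁∈𝓑 M₁-greedy x x∈M₁ x∉P x*∉P (J , ((J-adm , J-dependent) , J-minimal) , J−P≡x) =
    D-independent λ B₀ B₀∈𝓑 D⊆B₀ → with-M₃ greedy₃ B₀ B₀∈𝓑 D⊆B₀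
    where
    open SpanningCircuit P J x J−P≡x

    -- D is a proper subset of the circuit J
    D-independent : (∀ B → 𝓑 B → ¬ (D ⊆ₛ B)) → ⊥
    D-independent D-dependent =
      true≢false (trans (sym x∈J) (subst (λ A → mem A x ≡ false) D≡J x∉D))
      where
      D≡J : D ≡ J
      D≡J = J-minimal D (D-admissible J-adm , D-dependent) D⊆J

    P+x : E n → Bool
    P+x e = mem P e ∨ mem ⁅ x ⁆ₛ e

    D⊆P+x : ∀ e → mem D e ≡ true → P+x e ≡ true
    D⊆P+x e e∈D = cong (_∨ mem ⁅ x ⁆ₛ e) (D⊆P e e∈D)

    f₃ : E n → ℕ
    f₃ = twoLevel P+x (mem D)

    module L₃ = TwoLevel P+x (mem D) D⊆P+x

    greedy₃ : ∃[ M ] (𝓑 M × IsGreedy f₃ M)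
    greedy₃ = greedy-basis 2 f₃ L₃.bounded (L₃.support-admissible (add-admissible x P-adm x*∉P))

    M₁-gains-x : ∣ M₁ ∩ mem P ∣ < ∣ M₁ ∩ P+x ∣
    M₁-gains-x = cnt-strict (elems n) (λ e h → ∧-intro (∧-left h) (cong (_∨ mem ⁅ x ⁆ₛ e) (∧-right {mem M₁ e} h)))
                            (∈-elems x) (trans (cong (_∧ mem P x) x∈M₁) x∉P)
                            (∧-intro x∈M₁ (cong₂ _∨_ x∉P (mem-⁅⁆-self x)))

    misses-x : ∀ M → mem M x ≡ false → ∣ M ∩ P+x ∣ ≡ ∣ M ∩ mem P ∣
    misses-x M x∉M = cnt-ext (elems n) pointwise
      where
      pointwise : ∀ e → mem M e ∧ P+x e ≡ mem M e ∧ mem P e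
      pointwise e with mem ⁅ x ⁆ₛ e in e∈x
      ... | false = cong (mem M e ∧_) (∨-identityʳ (mem P e))
      ... | true with mem-⁅⁆ x e e∈x
      ...   | refl rewrite x∉M = refl

    x-inside : ∀ M → ∣ M ∩ mem P ∣ ≤ ∣ M₁ ∩ mem P ∣ → ∣ M₁ ∩ P+x ∣ ≤ ∣ M ∩ P+x ∣ → mem M x ≡ true
    x-inside M M≤M₁ M₁≤M = ¬-not λ x∉M → <-irrefl refl (begin-strict
      ∣ M₁ ∩ mem P ∣   <⟨ M₁-gains-x ⟩
      ∣ M₁ ∩ P+x ∣     ≤⟨ M₁≤M ⟩
      ∣ M ∩ P+x ∣      ≡⟨ misses-x M x∉M ⟩
      ∣ M ∩ mem P ∣    ≤⟨ M≤M₁ ⟩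
      ∣ M₁ ∩ mem P ∣   ∎)
      where open ≤-Reasoning

    D-inside : ∀ M → ∣ D ∣ₛ ≤ ∣ M ∩ mem D ∣ → D ⊆ₛ M
    D-inside M le y y∈D = cnt-∧-full (mem M) (mem D) (elems n) le (∈-elems y) y∈D

    J-inside : ∀ M → mem M x ≡ true → D ⊆ₛ M → J ⊆ₛ M
    J-inside M x∈M D⊆M y y∈J with J⊆D+x y y∈J
    ... | inj₁ refl = x∈M
    ... | inj₂ y∈D = D⊆M y y∈D

    with-M₃ : ∃[ M ] (𝓑 M × IsGreedy f₃ M) → ∀ B₀ → 𝓑 B₀ → D ⊆ₛ B₀ → ⊥
    with-M₃ (M₃ , M₃∈𝓑 , M₃-greedy) B₀ B₀∈𝓑 D⊆B₀ =
      M₃-greedy B₀ B₀∈𝓑 λ B₀≤M₃ →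
      M₃-greedy M₁ M₁∈𝓑 λ M₁≤M₃ →
      M₁-greedy M₃ M₃∈𝓑 λ M₃≤M₁ →
      J-dependent M₃ M₃∈𝓑 (J-inside M₃
        (x-inside M₃ (M₃≤M₁ 0 (mem P) L₁.level₀) (M₁≤M₃ 0 P+x L₃.level₀))
        (D-inside M₃ (subst (_≤ ∣ M₃ ∩ mem D ∣) (∩-⊇ D⊆B₀) (B₀≤M₃ 1 (mem D) L₃.level₁))))

theorem2 : (n : ℕ) (𝓑 : SSet n → Set) → IsSymplecticMatroid 𝓑 →
    (P : SSet n) → Admissible P → (B : SSet n) → 𝓑 B → ∣ P ∣ₛ < ∣ B ∣ₛ →
    ∃[ x ] ((mem P x ≡ false × mem P (x *) ≡ false) × ¬ Spans 𝓑 P x)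
theorem2 n 𝓑 matroid P P-adm B B∈𝓑 ∣P∣<∣B∣ = from-greedy greedy₁
  where
  open IsSymplecticMatroid matroid
  open Greedy matroid
  open NotSpanned matroid P P-adm
  from-greedy : ∃[ M ] (𝓑 M × IsGreedy f₁ M) → ∃[ x ] ((mem P x ≡ false × mem P (x *) ≡ false) × ¬ Spans 𝓑 P x)
  from-greedy (M₁ , M₁∈𝓑 , M₁-greedy) = conclude
    (free-element (admissible M₁ M₁∈𝓑) (subst (∣ P ∣ₛ <_) (equinumerous B M₁ B∈𝓑 M₁∈𝓑) ∣P∣<∣B∣))
    where
    conclude : ∃[ x ] (mem M₁ x ≡ true × mem P x ≡ false × mem P (x *) ≡ false) →
               ∃[ x ] ((mem P x ≡ false × mem P (x *) ≡ false) × ¬ Spans 𝓑 P x)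
    conclude (x , x∈M₁ , x∉P , x*∉P) =
      x , (x∉P , x*∉P) , not-spanned M₁ M₁∈𝓑 M₁-greedy x x∈M₁ x∉P x*∉P
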